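{- Let $\phi$ and $\psi$ be IFG$_N$-formulas and $\mathfrak A$ a suitable structure with universe $A$. Then $\mathfrak A\models^+\phi\leftrightarrow_{/\emptyset}\psi$ if and only if $\|\phi\|_{\mathfrak A}=\|\psi\|_{\mathfrak A}$ and this common value is perfect, i.e. equals $\langle\mathcal P(V),\mathcal P({}^NA\setminus V)\rangle$ for some $V\subseteq{}^NA$.
   Context: Identify $N$ with $\{0,\dots,N-1\}$; ${}^NA$ is the set of valuations $\vec a=(a_0,\dots,a_{N-1})$; a team is a subset of ${}^NA$. For $J\subseteq N$, $\vec a\approx_J\vec b$ means they agree on $N\setminus J$. $V=V_1\cup_J V_2$ means $V_1\cup V_2=V$, $V_1\cap V_2=\emptyset$, and each $V_i$ is closed under $\approx_J$ within $V$. $f:V\to A$ is independent of $J$ if $f(\vec a)=f(\vec b)$ whenever $\vec a\approx_J\vec b$. $\vec a(n:b)$ is $\vec a$ with $n$th coordinate replaced by $b$; $V(n:f)=\{\vec a(n:f(\vec a)):\vec a\in V\}$; $W(n:A)=\{\vec a(n:b):\vec a\in W,b\in A\}$. IFG$_N$-formulas in variables $v_0,\dots,v_{N-1}$ are built from atomic first-order formulas by $\sim\phi$, $\phi\vee_{/J}\psi$ ($J\subseteq N$) and $(\exists v_n/J)\phi$. Abbreviations: $\phi\wedge_{/J}\psi:=\sim(\sim\phi\vee_{/J}\sim\psi)$, $\phi\to_{/J}\psi:=\sim\phi\vee_{/J}\psi$, $\phi\leftrightarrow_{/J}\psi:=(\phi\to_{/J}\psi)\wedge_{/J}(\psi\to_{/J}\phi)$.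 For a structure $\mathfrak A$ with universe $A$ and teams $V,W$, $\mathfrak A\models^+\phi[V]$ and $\mathfrak A\models^-\phi[W]$ are defined recursively: atomic: every $\vec a\in V$ satisfies $\phi$ / no $\vec b\in W$ satisfies $\phi$; $\mathfrak A\models^\pm\sim\psi[V]$ iff $\mathfrak A\models^\mp\psi[V]$; $\mathfrak A\models^+\psi_1\vee_{/J}\psi_2[V]$ iff $\mathfrak A\models^+\psi_1[V_1]$ and $\mathfrak A\models^+\psi_2[V_2]$ for some $V=V_1\cup_JV_2$, and $\mathfrak A\models^-\psi_1\vee_{/J}\psi_2[W]$ iff $\mathfrak A\models^-\psi_i[W]$ for $i=1,2$; $\mathfrak A\models^+(\exists v_n/J)\psi[V]$ iff $\mathfrak A\models^+\psi[V(n:f)]$ for some $f:V\to A$ independent of $J$, and $\mathfrak A\models^-(\exists v_n/J)\psi[W]$ iff $\mathfrak A\models^-\psi[W(n:A)]$. $\mathfrak A\models^+\phi$ means $\mathfrak A\models^+\phi[{}^NA]$. The meaning is $\|\phi\|_{\mathfrak A}=\langle\{V:\mathfrak A\models^+\phi[V]\},\{W:\mathfrak A\models^-\phi[W]\}\rangle$. -}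

module Defs where

open import Level using (Level; 0ℓ; Lift) renaming (suc to lsuc)
open import Data.Nat using (ℕ)
open import Data.Fin using (Fin; _≟_)
open import Data.Fin.Subset using (Subset; _∈_; ⊥)
open import Data.Vec using (Vec; []; _∷_)
open import Data.Product using (Σ; _×_; _,_)
open import Data.Sum using (_⊎_)
open import Data.Unit using (⊤)
open import Data.Empty renaming (⊥ to Empty)
open import Relation.Nullary using (¬_; yes; no)
open import Relation.Binary.PropositionalEquality using (_≡_)

record Signature : Set₁ where
  field
    Fun   : Set
    funAr : Fun → ℕ
    Rel   : Set
    relAr : Rel → ℕ

record Structure (σ : Signature) : Set₁ where
  open Signature σ
  field
    Carrier : Set
    funI    : (f : Fun) → Vec Carrier (funAr f) → Carrier
    relI    : (R : Rel) → Vec Carrier (relAr R) → Set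

module Syntax (σ : Signature) (N : ℕ) where
  open Signature σ

  data Term : Set where
    var : Fin N → Term
    app : (f : Fun) → Vec Term (funAr f) → Term

  data Atom : Set where
    _≐_ : Term → Term → Atom
    rel : (R : Rel) → Vec Term (relAr R) → Atom

  data Form : Set where
    atom : Atom → Form
    ∼_   : Form → Form
    _∨[_]_ : Form → Subset N → Form → Form
    ∃[_/_]_ : Fin N → Subset N → Form → Form

  _∧[_]_ : Form → Subset N → Form → Form
  φ ∧[ J ] ψ = ∼ ((∼ φ) ∨[ J ] (∼ ψ))

  _⇒[_]_ : Form → Subset N → Form → Form
  φ ⇒[ J ] ψ = (∼ φ) ∨[ J ] ψ

  _⇔[_]_ : Form → Subset N → Form → Form
  φ ⇔[ J ] ψ = (φ ⇒[ J ] ψ) ∧[ J ] (ψ ⇒[ J ] φ)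

  ∅ : Subset N
  ∅ = ⊥

module Semantics {σ : Signature} (𝔄 : Structure σ) (N : ℕ) where
  open Signature σ
  open Structure 𝔄 renaming (Carrier to A)
  open Syntax σ N public

  Val : Set
  Val = Fin N → A

  Team : Set₁
  Team = Val → Set

  fullTeam : Team
  fullTeam _ = ⊤

  _⊆_ : Team → Team → Set
  X ⊆ Y = ∀ a → X a → Y a

  complement : Team → Team
  complement V a = ¬ V a

  _≗_ : Val → Val → Set
  a ≗ b = ∀ i → a i ≡ b i

  _≈[_]_ : Val → Subset N → Val → Set
  a ≈[ J ] b = ∀ i → ¬ (i ∈ J) → a i ≡ b i

  upd : Val → Fin N → A → Val
  upd a n b i with i ≟ n
  ... | yes _ = b
  ... | no  _ = a i

  Split : Subset N → Team → Team → Team → Set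
  Split J V V₁ V₂ =
      (∀ a → V a → V₁ a ⊎ V₂ a)
    × (V₁ ⊆ V) × (V₂ ⊆ V)
    × (∀ a → V₁ a → V₂ a → Empty)
    × (∀ a b → V₁ a → V b → a ≈[ J ] b → V₁ b)
    × (∀ a b → V₂ a → V b → a ≈[ J ] b → V₂ b)

  TeamFun : Team → Set
  TeamFun V = (a : Val) → V a → A

  Independent : (V : Team) → Subset N → TeamFun V → Set
  Independent V J f = ∀ a b (p : V a) (q : V b) → a ≈[ J ] b → f a p ≡ f b q

  updF : (V : Team) → Fin N → TeamFun V → Team
  updF V n f c = Σ Val λ a → Σ (V a) λ p → c ≗ upd a n (f a p)

  updA : Team → Fin N → Team
  updA W n c = Σ Val λ a → W a × Σ A λ b → c ≗ upd a n b

  mutual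
    evalT : Term → Val → A
    evalT (var i)    a = a i
    evalT (app f ts) a = funI f (evalTs ts a)

    evalTs : ∀ {k} → Vec Term k → Val → Vec A k
    evalTs []       a = []
    evalTs (t ∷ ts) a = evalT t a ∷ evalTs ts a

  ⟦_⟧ₐ : Atom → Val → Set
  ⟦ t ≐ s ⟧ₐ a = evalT t a ≡ evalT s a
  ⟦ rel R ts ⟧ₐ a = relI R (evalTs ts a)

  mutual
    sat⁺ : Form → Team → Set₁
    sat⁺ (atom α) V = Lift (lsuc 0ℓ) (∀ a → V a → ⟦ α ⟧ₐ a)
    sat⁺ (∼ φ) V = sat⁻ φ V
    sat⁺ (φ ∨[ J ] ψ) V =
      Σ Team λ V₁ → Σ Team λ V₂ → Split J V V₁ V₂ × sat⁺ φ V₁ × sat⁺ ψ V₂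
    sat⁺ (∃[ n / J ] φ) V =
      Σ (TeamFun V) λ f → Independent V J f × sat⁺ φ (updF V n f)

    sat⁻ : Form → Team → Set₁
    sat⁻ (atom α) W = Lift (lsuc 0ℓ) (∀ b → W b → ¬ ⟦ α ⟧ₐ b)
    sat⁻ (∼ φ) W = sat⁺ φ W
    sat⁻ (φ ∨[ J ] ψ) W = sat⁻ φ W × sat⁻ ψ W
    sat⁻ (∃[ n / J ] φ) W = sat⁻ φ (updA W n)

  Holds : Form → Set₁
  Holds φ = sat⁺ φ fullTeam

  _↔_ : Set₁ → Set₁ → Set₁
  P ↔ Q = (P → Q) × (Q → P)

  -- ‖φ‖ = ‖ψ‖  (equality of the pairs of sets of teams, extensionally)
  SameMeaning : Form → Form → Set₁
  SameMeaning φ ψ = ∀ (X : Team) → (sat⁺ φ X ↔ sat⁺ ψ X) × (sat⁻ φ X ↔ sat⁻ ψ X)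

  Perfect : Form → Set₁
  Perfect φ = Σ Team λ V → ∀ (X : Team) →
    (sat⁺ φ X ↔ Lift (lsuc 0ℓ) (X ⊆ V)) × (sat⁻ φ X ↔ Lift (lsuc 0ℓ) (X ⊆ complement V))

module Submission where

-- Team semantics has two basic features, proved first for every formula:
--   * downward closure: ⊨⁺ φ and ⊨⁻ φ survive passing to a team all of
--     whose valuations are (pointwise) equal to members of the old team;
--   * consistency: no nonempty team satisfies both ⊨⁺ φ and ⊨⁻ φ, hence a
--     team satisfying ⊨⁺ φ is disjoint from one satisfying ⊨⁻ φ.
-- From these, a formula φ with  ⊨⁻ φ [W⁻],  ⊨⁺ φ [W⁺]  and  W⁻ ∪ W⁺ = ^N A  is
-- perfect with witness W⁺, and two formulas perfect with the same witness have
-- the same meaning.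
--
-- (⇒) Unfolding, 𝔄 ⊨⁺ φ ↔_{/∅} ψ gives two covers  V₁ ∪ V₂  and  U₁ ∪ U₂  of
-- ^N A with  ⊨⁻φ[V₁], ⊨⁺ψ[V₂], ⊨⁻ψ[U₁], ⊨⁺φ[U₂].  By consistency V₂ ⊆ U₂ and
-- V₁ ⊆ U₁, so both φ and ψ are determined on the cover V₁ ∪ V₂, hence both are
-- perfect with witness V₂ and have the same meaning.
-- (⇐) A perfect witness V is closed under pointwise equality of valuations,
-- so (with excluded middle) ^N A = (^N A ∖ V) ∪_∅ V, and this single split
-- verifies both conjuncts of the biconditional.

open import Defs
open import Level using (0ℓ; Lift; lift; lower) renaming (suc to lsuc)
open import Axiom.ExcludedMiddle using (ExcludedMiddle)
open import Data.Nat using (ℕ)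
open import Data.Product using (_×_; Σ; _,_; proj₁; proj₂)
open import Data.Sum using (_⊎_; inj₁; inj₂; swap)
open import Data.Unit using (tt)
open import Data.Empty using () renaming (⊥ to Empty; ⊥-elim to absurd)
open import Data.Vec using (Vec; []; _∷_)
open import Data.Fin using (_≟_)
open import Data.Fin.Subset.Properties using (∉⊥)
open import Relation.Nullary using (¬_; yes; no)
open import Relation.Binary.PropositionalEquality using (_≡_; refl; sym; trans; cong; cong₂; subst)

module TeamSemanticsFacts {σ : Signature} (𝔄 : Structure σ) (N : ℕ) where
  open Signature σ
  open Structure 𝔄 renaming (Carrier to A)
  open Semantics 𝔄 N

  ≗-refl : ∀ {a} → a ≗ a
  ≗-refl _ = refl

  ≗-sym : ∀ {a b} → a ≗ b → b ≗ a
  ≗-sym e i = sym (e i)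

  ≗-trans : ∀ {a b c} → a ≗ b → b ≗ c → a ≗ c
  ≗-trans e f i = trans (e i) (f i)

  ≈-resp-≗ : ∀ {J a a' b b'} → a ≗ b → a ≈[ J ] a' → a' ≗ b' → b ≈[ J ] b'
  ≈-resp-≗ e j e' i i∉J = trans (sym (e i)) (trans (j i i∉J) (e' i))

  ≈∅⇒≗ : ∀ {a b} → a ≈[ ∅ ] b → a ≗ b
  ≈∅⇒≗ j i = j i ∉⊥

  upd-cong : ∀ {a b} n x → a ≗ b → upd a n x ≗ upd b n x
  upd-cong n x e i with i ≟ n
  ... | yes _ = refl
  ... | no  _ = e i

  mutual
    evalT-cong : ∀ {a b} → a ≗ b → (t : Term) → evalT t a ≡ evalT t b
    evalT-cong e (var i)    = e i
    evalT-cong e (app f ts) = cong (funI f) (evalTs-cong e ts)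

    evalTs-cong : ∀ {a b k} → a ≗ b → (ts : Vec Term k) → evalTs ts a ≡ evalTs ts b
    evalTs-cong e []       = refl
    evalTs-cong e (t ∷ ts) = cong₂ _∷_ (evalT-cong e t) (evalTs-cong e ts)

  atom-cong : ∀ {a b} (α : Atom) → a ≗ b → ⟦ α ⟧ₐ b → ⟦ α ⟧ₐ a
  atom-cong (t ≐ s)    e h = trans (evalT-cong e t) (trans h (sym (evalT-cong e s)))
  atom-cong (rel R ts) e h = subst (relI R) (sym (evalTs-cong e ts)) h

  -- This is
  -- inclusion "up to ≗", the form of downward closure that survives the
  -- quantifier clauses (whose teams are only defined up to ≗).
  _≲_ : Team → Team → Set
  X ≲ Y = ∀ a → X a → Σ Val λ b → Y b × a ≗ b

  ⊆⇒≲ : ∀ {X Y} → X ⊆ Y → X ≲ Y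
  ⊆⇒≲ s a p = a , s a p , ≗-refl

  _↾_ : Team → Team → Team
  (X ↾ Y) a = X a × Σ Val λ b → Y b × a ≗ b

  ↾-closed : ∀ {J X Y Z} → X ≲ Y →
    (∀ b b' → Z b → Y b' → b ≈[ J ] b' → Z b') →
    ∀ a a' → (X ↾ Z) a → X a' → a ≈[ J ] a' → (X ↾ Z) a'
  ↾-closed le closed a a' (_ , b , r , e) p' j with le a' p'
  ... | b' , q' , e' = p' , b' , closed b b' r q' (≈-resp-≗ e j e') , e'

  split-≲ : ∀ {J X Y Y₁ Y₂} → X ≲ Y → Split J Y Y₁ Y₂ → Split J X (X ↾ Y₁) (X ↾ Y₂)
  split-≲ {X = X} {Y₁ = Y₁} {Y₂ = Y₂} le (cov , _ , Y₂⊆Y , disj , cl₁ , cl₂) =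
    cov' , (λ _ → proj₁) , (λ _ → proj₁) , disj' , ↾-closed le cl₁ , ↾-closed le cl₂
    where
    cov' : ∀ a → X a → (X ↾ Y₁) a ⊎ (X ↾ Y₂) a
    cov' a p with le a p
    ... | b , q , e with cov b q
    ... | inj₁ r = inj₁ (p , b , r , e)
    ... | inj₂ r = inj₂ (p , b , r , e)
    disj' : ∀ a → (X ↾ Y₁) a → (X ↾ Y₂) a → Empty
    disj' a (_ , b₁ , r₁ , e₁) (_ , b₂ , r₂ , e₂) =
      disj b₂ (cl₁ b₁ b₂ r₁ (Y₂⊆Y b₂ r₂) (λ i _ → trans (sym (e₁ i)) (e₂ i))) r₂

  mutual
    mono⁺ : ∀ φ {X Y} → X ≲ Y → sat⁺ φ Y → sat⁺ φ X
    mono⁺ (atom α) le (lift h) = lift λ a p →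
      let (b , q , e) = le a p in atom-cong α e (h b q)
    mono⁺ (∼ φ) le h = mono⁻ φ le h
    mono⁺ (φ ∨[ J ] ψ) {X} le (Y₁ , Y₂ , split , h₁ , h₂) =
      X ↾ Y₁ , X ↾ Y₂ , split-≲ le split ,
      mono⁺ φ (λ a (_ , c) → c) h₁ , mono⁺ ψ (λ a (_ , c) → c) h₂
    mono⁺ (∃[ n / J ] φ) {X} {Y} le (f , ind , h) = g , ind' , mono⁺ φ le' h
      where
      g : TeamFun X
      g a p = let (b , q , _) = le a p in f b q
      ind' : Independent X J g
      ind' a a' p p' j with le a p | le a' p'
      ... | b , q , e | b' , q' , e' = ind b b' q q' (≈-resp-≗ e j e')
      le' : updF X n g ≲ updF Y n f
      le' c (a , p , e) with le a p
      ... | b , q , e' = upd b n (f b q) , (b , q , ≗-refl) , ≗-trans e (upd-cong n (f b q) e')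

    mono⁻ : ∀ φ {X Y} → X ≲ Y → sat⁻ φ Y → sat⁻ φ X
    mono⁻ (atom α) le (lift h) = lift λ a p r →
      let (b , q , e) = le a p in h b q (atom-cong α (≗-sym e) r)
    mono⁻ (∼ φ) le h = mono⁺ φ le h
    mono⁻ (φ ∨[ J ] ψ) le (h₁ , h₂) = mono⁻ φ le h₁ , mono⁻ ψ le h₂
    mono⁻ (∃[ n / J ] φ) {X} {Y} le h = mono⁻ φ le' h
      where
      le' : updA X n ≲ updA Y n
      le' c (a , p , x , e) with le a p
      ... | b , q , e' = upd b n x , (b , q , x , ≗-refl) , ≗-trans e (upd-cong n x e')

  consistent : ∀ φ {X} → sat⁺ φ X → sat⁻ φ X → ∀ a → ¬ X a
  consistent (atom α) (lift h) (lift k) a p = k a p (h a p)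
  consistent (∼ φ) h k = consistent φ k h
  consistent (φ ∨[ J ] ψ) (_ , _ , (cov , X₁⊆X , X₂⊆X , _) , h₁ , h₂) (k₁ , k₂) a p
    with cov a p
  ... | inj₁ r = consistent φ h₁ (mono⁻ φ (⊆⇒≲ X₁⊆X) k₁) a r
  ... | inj₂ r = consistent ψ h₂ (mono⁻ ψ (⊆⇒≲ X₂⊆X) k₂) a r
  consistent (∃[ n / J ] φ) {X} (f , _ , h) k a p =
    consistent φ h (mono⁻ φ (⊆⇒≲ witnessed⊆all) k) (upd a n (f a p)) (a , p , ≗-refl)
    where
    witnessed⊆all : updF X n f ⊆ updA X n
    witnessed⊆all c (b , q , e) = b , q , f b q , e

  disjoint : ∀ φ {X Y} → sat⁺ φ X → sat⁻ φ Y → ∀ a → X a → Y a → Empty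
  disjoint φ {X} {Y} h k a p q =
    consistent φ {λ c → X c × Y c} (mono⁺ φ (⊆⇒≲ λ _ → proj₁) h)
      (mono⁻ φ (⊆⇒≲ λ _ → proj₂) k) a (p , q)

  avoid : ∀ {X Y Z : Team} → (∀ a → Y a ⊎ Z a) → (∀ a → X a → Y a → Empty) → X ⊆ Z
  avoid cov disj a p with cov a
  ... | inj₁ q = absurd (disj a p q)
  ... | inj₂ q = q

  PerfectWith : Form → Team → Set₁
  PerfectWith φ V = ∀ (X : Team) →
    (sat⁺ φ X ↔ Lift (lsuc 0ℓ) (X ⊆ V)) × (sat⁻ φ X ↔ Lift (lsuc 0ℓ) (X ⊆ complement V))

  perfect-from-cover : ∀ φ {W⁻ W⁺} → (∀ a → W⁻ a ⊎ W⁺ a) →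
    sat⁻ φ W⁻ → sat⁺ φ W⁺ → PerfectWith φ W⁺
  perfect-from-cover φ cov k h X =
    ( (λ hX → lift (avoid cov λ a p q → disjoint φ hX k a p q))
    , (λ X⊆W⁺ → mono⁺ φ (⊆⇒≲ (lower X⊆W⁺)) h) )
    ,
    ( (λ kX → lift λ a p q → disjoint φ h kX a q p)
    , (λ X⊆∁W⁺ → mono⁻ φ (⊆⇒≲ (avoid (λ a → swap (cov a)) (lower X⊆∁W⁺))) k) )

  same-witness⇒same-meaning : ∀ φ ψ {V} → PerfectWith φ V → PerfectWith ψ V → SameMeaning φ ψ
  same-witness⇒same-meaning φ ψ pφ pψ X =
    ( (λ h → proj₂ (proj₁ (pψ X)) (proj₁ (proj₁ (pφ X)) h))
    , (λ h → proj₂ (proj₁ (pφ X)) (proj₁ (proj₁ (pψ X)) h)) )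
    ,
    ( (λ h → proj₂ (proj₂ (pψ X)) (proj₁ (proj₂ (pφ X)) h))
    , (λ h → proj₂ (proj₂ (pφ X)) (proj₁ (proj₂ (pψ X)) h)) )

  -- A perfect witness is closed under pointwise equality: the singleton {a}
  -- lies in V, so by downward closure so does everything ≗ a.
  witness-closed : ∀ φ {V} → PerfectWith φ V → ∀ a b → V a → a ≗ b → V b
  witness-closed φ {V} pφ a b p e =
    lower (proj₁ (proj₁ (pφ (λ c → c ≗ a))) (mono⁺ φ class≲singleton satSingleton)) b (≗-sym e)
    where
    satSingleton : sat⁺ φ (λ c → c ≡ a)
    satSingleton = proj₂ (proj₁ (pφ (λ c → c ≡ a))) (lift λ { c refl → p })
    class≲singleton : (λ c → c ≗ a) ≲ (λ c → c ≡ a)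
    class≲singleton c e' = a , refl , e'

  closed-split : ExcludedMiddle 0ℓ → ∀ {V} → (∀ a b → V a → a ≗ b → V b) →
    Split ∅ fullTeam (complement V) V
  closed-split em {V} closed =
    cov , (λ _ _ → tt) , (λ _ _ → tt) , (λ a p q → p q) ,
    (λ a b p _ j q → p (closed b a q (≗-sym (≈∅⇒≗ j)))) ,
    (λ a b p _ j → closed a b p (≈∅⇒≗ j))
    where
    cov : ∀ a → fullTeam a → complement V a ⊎ V a
    cov a _ with em {V a}
    ... | yes p = inj₂ p
    ... | no ¬p = inj₁ ¬p

  forward : ∀ φ ψ → Holds (φ ⇔[ ∅ ] ψ) → SameMeaning φ ψ × Perfect φ
  forward φ ψ ((V₁ , V₂ , (coverV , _) , φ⁻V₁ , ψ⁺V₂) , (U₁ , U₂ , (coverU , _) , ψ⁻U₁ , φ⁺U₂)) =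
    same-witness⇒same-meaning φ ψ perfectφ perfectψ , (V₂ , perfectφ)
    where
    V₂⊆U₂ : V₂ ⊆ U₂
    V₂⊆U₂ = avoid (λ a → coverU a tt) (disjoint ψ ψ⁺V₂ ψ⁻U₁)
    V₁⊆U₁ : V₁ ⊆ U₁
    V₁⊆U₁ = avoid (λ a → swap (coverU a tt)) λ a p q → disjoint φ φ⁺U₂ φ⁻V₁ a q p
    perfectφ : PerfectWith φ V₂
    perfectφ = perfect-from-cover φ (λ a → coverV a tt) φ⁻V₁ (mono⁺ φ (⊆⇒≲ V₂⊆U₂) φ⁺U₂)
    perfectψ : PerfectWith ψ V₂
    perfectψ = perfect-from-cover ψ (λ a → coverV a tt) (mono⁻ ψ (⊆⇒≲ V₁⊆U₁) ψ⁻U₁) ψ⁺V₂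

  backward : ExcludedMiddle 0ℓ → ∀ φ ψ → SameMeaning φ ψ × Perfect φ → Holds (φ ⇔[ ∅ ] ψ)
  backward em φ ψ (same , (V , perfectφ)) =
    (complement V , V , split , φ⁻∁V , proj₁ (proj₁ (same V)) φ⁺V) ,
    (complement V , V , split , proj₁ (proj₂ (same (complement V))) φ⁻∁V , φ⁺V)
    where
    split : Split ∅ fullTeam (complement V) V
    split = closed-split em (witness-closed φ perfectφ)
    φ⁺V : sat⁺ φ V
    φ⁺V = proj₂ (proj₁ (perfectφ V)) (lift λ _ p → p)
    φ⁻∁V : sat⁻ φ (complement V)
    φ⁻∁V = proj₂ (proj₂ (perfectφ (complement V))) (lift λ _ p → p)

mainTheorem8 : ExcludedMiddle 0ℓ → {σ : Signature} (𝔄 : Structure σ) (N : ℕ) →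
    let open Semantics 𝔄 N in
    (φ ψ : Form) → Holds (φ ⇔[ ∅ ] ψ) ↔ (SameMeaning φ ψ × Perfect φ)
mainTheorem8 em 𝔄 N φ ψ = forward φ ψ , backward em φ ψ
  where open TeamSemanticsFacts 𝔄 N
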